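{- Let $\vec{D}$ and $\vec{E}$ be directed acyclic graphs whose vertex sets are disjoint finite subsets of $\mathbb{P}$. Then $$\Delta^{\mathrm{cyc}}_{[\vec{D}\uplus\vec{E}]}=\Delta^{\mathrm{cyc}}_{[\vec{D}]}\cdot\Delta^{\mathrm{cyc}}_{[\vec{E}]}.$$
   Context: $\mathbb{P}$ is the set of positive integers. The union $\vec{D}\uplus\vec{E}$ is the digraph whose vertex set is the union of the vertex sets and whose arc set is the union of the arc sets. Let $\mathbb{P}'$ be the nonzero integers ordered $-1\prec 1\prec -2\prec 2\prec\cdots$. For a DAG $\vec{D}$ on finite vertex set $V\subset\mathbb{P}$, an enriched $\vec{D}$-partition is $f:V\to\mathbb{P}'$ such that for each arc $i\to j$: $f(i)\preceq f(j)$; $f(i)=f(j)>0$ implies $i<j$; $f(i)=f(j)<0$ implies $i>j$ (usual integer order); $\mathcal{E}(\vec{D})$ is their set. A flip at a source or sink $i_0$ reverses all arcs incident to $i_0$; the toric DAG $[\vec{D}]$ is the class of DAGs obtainable from $\vec{D}$ by sequences of flips. $\mathcal{E}^{\mathrm{tor}}([\vec{D}])=\bigcup_{\vec{D}'\in[\vec{D}]}\mathcal{E}(\vec{D}')$ is the set of enriched toric $[\vec{D}]$-partitions, and $\Delta^{\mathrm{cyc}}_{[\vec{D}]}=\sum_{f\in\mathcal{E}^{\mathrm{tor}}([\vec{D}])}\prod_{i\in V}x_{|f(i)|}$. -}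

module Defs where

open import Data.Nat using (ℕ; zero; suc; _<_; _∸_; _*_; _≟_)
open import Data.Bool using (Bool; true; false; _∨_; if_then_else_)
open import Data.Nat using (_≡ᵇ_)
open import Data.Product using (_×_; _,_; proj₁; proj₂; ∃)
open import Data.Sum using (_⊎_)
open import Data.Fin using (Fin; toℕ)
open import Data.Vec using (Vec; []; _∷_; lookup)
open import Data.List using (List; []; _∷_; _++_; map; concatMap; upTo; filter; length)
open import Data.Nat.ListAction using (sum)
open import Data.List.Membership.Propositional using (_∈_)
open import Data.List.Relation.Unary.All using (All)
open import Data.List.Relation.Unary.Unique.Propositional using (Unique)
open import Relation.Binary.PropositionalEquality using (_≡_)
open import Relation.Binary.Construct.Closure.Transitive using (TransClosure)
open import Relation.Binary.Construct.Closure.ReflexiveTransitive using (Star)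
open import Relation.Nullary using (¬_)

-- The ordered set ℙ' of nonzero integers: ⟨ k , s ⟩ encodes the integer
-- (k+1) if s = true and -(k+1) if s = false.
-- Order: -1 ≺ 1 ≺ -2 ≺ 2 ≺ ⋯

record P' : Set where
  constructor ⟨_,_⟩
  field
    mag : ℕ
    pos : Bool
open P' public

∣_∣' : P' → ℕ
∣ a ∣' = suc (mag a)

_≺_ : P' → P' → Set
a ≺ b = (mag a < mag b) ⊎ ((mag a ≡ mag b) × (pos a ≡ false) × (pos b ≡ true))

_⪯_ : P' → P' → Set
a ⪯ b = (a ≡ b) ⊎ (a ≺ b)

record Digraph : Set where
  constructor digraph
  field
    verts : List ℕ
    arcs  : List (ℕ × ℕ)
open Digraph public

WellFormed : Digraph → Set
WellFormed D = Unique (verts D) × All (λ v → 0 < v) (verts D)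
             × All (λ a → (proj₁ a ∈ verts D) × (proj₂ a ∈ verts D)) (arcs D)

Arc : Digraph → ℕ → ℕ → Set
Arc D i j = (i , j) ∈ arcs D

Acyclic : Digraph → Set
Acyclic D = ∀ i → ¬ TransClosure (Arc D) i i

IsDAG : Digraph → Set
IsDAG D = WellFormed D × Acyclic D

_⊎ᴰ_ : Digraph → Digraph → Digraph
D ⊎ᴰ E = digraph (verts D ++ verts E) (arcs D ++ arcs E)

DisjointVerts : Digraph → Digraph → Set
DisjointVerts D E = ∀ v → v ∈ verts D → ¬ (v ∈ verts E)

IsSource IsSink : Digraph → ℕ → Set
IsSource D i = ∀ j → ¬ Arc D j i
IsSink   D i = ∀ j → ¬ Arc D i j

flipArc : ℕ → ℕ × ℕ → ℕ × ℕ
flipArc i (a , b) = if (a ≡ᵇ i) ∨ (b ≡ᵇ i) then (b , a) else (a , b)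

flipAt : ℕ → Digraph → Digraph
flipAt i D = digraph (verts D) (map (flipArc i) (arcs D))

data FlipStep : Digraph → Digraph → Set where
  flip : ∀ {D} i → i ∈ verts D → IsSource D i ⊎ IsSink D i → FlipStep D (flipAt i D)

InToric : Digraph → Digraph → Set
InToric D D' = Star FlipStep D D'

-- Enriched partitions.  A map f : V → ℙ' is encoded as its graph, a list of
-- pairs (v , f v), one for each vertex v.

Assignment : Set
Assignment = List (ℕ × P')

ArcCond : ℕ → ℕ → P' → P' → Set
ArcCond i j a b = (a ⪯ b)
                × (a ≡ b → pos a ≡ true → i < j)
                × (a ≡ b → pos a ≡ false → j < i)

IsEnriched : Digraph → Assignment → Set
IsEnriched D f = ∀ i j a b → Arc D i j → (i , a) ∈ f → (j , b) ∈ f → ArcCond i j a b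

IsEnrichedToric : Digraph → Assignment → Set
IsEnrichedToric D f = ∃ λ D' → InToric D D' × IsEnriched D' f

-- Coefficients of Δ^cyc_[D].
-- Every monomial involves finitely many variables, so it is x₁^α₁ ⋯ x_N^α_N
-- for some N and α : Vec ℕ N (entry k ↔ exponent of x_{k+1}).

valsUpTo : ℕ → List P'
valsUpTo N = concatMap (λ k → ⟨ k , false ⟩ ∷ ⟨ k , true ⟩ ∷ []) (upTo N)

assignments : ℕ → List ℕ → List Assignment
assignments N [] = [] ∷ []
assignments N (v ∷ vs) = concatMap (λ a → map ((v , a) ∷_) (assignments N vs)) (valsUpTo N)

-- ∏_{i ∈ V} x_{|f(i)|} = x^α
HasWeight : {N : ℕ} → Assignment → Vec ℕ N → Set
HasWeight {N} f α = ∀ (k : Fin N) → length (filter (λ p → mag (proj₂ p) ≟ toℕ k) f) ≡ lookup α k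

data Count {A : Set} (P : A → Set) : List A → ℕ → Set where
  c-nil  : Count P [] 0
  c-yes  : ∀ {x xs n} → P x → Count P xs n → Count P (x ∷ xs) (suc n)
  c-no   : ∀ {x xs n} → ¬ P x → Count P xs n → Count P (x ∷ xs) n

CoeffIs : (D : Digraph) {N : ℕ} → Vec ℕ N → ℕ → Set
CoeffIs D {N} α n =
  Count (λ f → IsEnrichedToric D f × HasWeight f α) (assignments N (verts D)) n

splits : {N : ℕ} → Vec ℕ N → List (Vec ℕ N × Vec ℕ N)
splits [] = ([] , []) ∷ []
splits (a ∷ α) = concatMap (λ i → map (λ bc → (i ∷ proj₁ bc) , ((a ∸ i) ∷ proj₂ bc)) (splits α))
                           (upTo (suc a))

prodCoeff : {N : ℕ} → (Vec ℕ N → ℕ) → (Vec ℕ N → ℕ) → Vec ℕ N → ℕ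
prodCoeff c d α = sum (map (λ bc → c (proj₁ bc) * d (proj₂ bc)) (splits α))

-- Since no arc joins the vertex sets of D and E, a vertex of D is a source or sink of D ⊎ E
-- exactly when it is one of D, and flipping it does not touch E.  Hence the toric class
-- [D ⊎ E] consists of the unions D′ ⊎ E′ with D′ ∈ [D] and E′ ∈ [E], and since the
-- conditions on an enriched partition are imposed arc by arc, f ⊎ g is an enriched toric
-- [D ⊎ E]-partition iff f and g are enriched toric partitions of [D] and [E].  The monomial
-- of f ⊎ g is the product of those of f and g, so counting such pairs by the exponents of
-- the two monomials gives the convolution of the coefficients of Δ_[D] and Δ_[E].

module Submission where

open import Defs
open import Algebra.Properties.CommutativeSemigroup using (interchange)
open import Data.Bool using (Bool; true; false; _∧_; _∨_; if_then_else_)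
open import Data.Empty using (⊥-elim)
open import Data.Fin as Fin using (Fin; toℕ)
open import Data.List using (List; []; _∷_; _++_; map; concatMap; upTo; applyUpTo; cartesianProductWith; filter; length)
import Data.List.Properties as List
open import Data.List.Membership.Propositional using (_∈_)
open import Data.List.Membership.Propositional.Properties using (∈-++⁺ˡ; ∈-++⁺ʳ; ∈-++⁻; ∈-map⁻; ∈-concatMap⁻)
import Data.List.Relation.Unary.All as All
open import Data.List.Relation.Unary.Any as Any using (here; there)
open import Data.Nat using (ℕ; zero; suc; _+_; _*_; _∸_; _≤_; _≡ᵇ_; _≟_; _≤?_; _<?_)
open import Data.Nat.ListAction using (sum)
open import Data.Nat.ListAction.Properties using (sum-++)
open import Data.Nat.Properties using (+-identityʳ; m≤m+n; m+[n∸m]≡n; +-cancelˡ-≡; *-distribʳ-+; +-commutativeSemigroup)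
open import Data.Product using (_×_; _,_; proj₁; proj₂; ∃; swap)
open import Data.Product.Function.NonDependent.Propositional using (_×-⇔_)
open import Data.Sum as Sum using (_⊎_; inj₁; inj₂; [_,_]′)
open import Data.Vec using (Vec; []; _∷_; zipWith; tabulate; lookup)
open import Data.Vec.Properties using (≡-dec; ∷-injective; tabulate-cong; tabulate∘lookup; lookup∘tabulate)
open import Data.Vec.Relation.Binary.Pointwise.Inductive as Pointwise using (Pointwise; []; _∷_)
open import Function using (id; _∘_; _⇔_; Equivalence; mk⇔)
open import Function.Construct.Identity using (⇔-id)
open import Relation.Binary.Construct.Closure.ReflexiveTransitive using (ε; _◅_)
open import Relation.Binary.PropositionalEquality
open import Relation.Nullary using (¬_; Dec; yes; no; does; _×-dec_)
open import Relation.Nullary.Decidable using (dec-true; dec-false; map′)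

open Equivalence

private variable
  A X Y Z : Set
  N : ℕ

module _ {P : A → Set} where

  count-unique : ∀ {xs m n} → Count P xs m → Count P xs n → m ≡ n
  count-unique c-nil         c-nil         = refl
  count-unique (c-yes p c)   (c-yes _ d)   = cong suc (count-unique c d)
  count-unique (c-yes p _)   (c-no ¬p _)   = ⊥-elim (¬p p)
  count-unique (c-no ¬p _)   (c-yes p _)   = ⊥-elim (¬p p)
  count-unique (c-no _ c)    (c-no _ d)    = count-unique c d

  count-++ : ∀ {xs ys m n} → Count P xs m → Count P ys n → Count P (xs ++ ys) (m + n)
  count-++ c-nil       d = d
  count-++ (c-yes p c) d = c-yes p (count-++ c d)
  count-++ (c-no ¬p c) d = c-no ¬p (count-++ c d)

  count-none : ∀ xs → (∀ {x} → x ∈ xs → ¬ P x) → Count P xs 0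
  count-none []       _    = c-nil
  count-none (x ∷ xs) none = c-no (none (here refl)) (count-none xs (none ∘ there))

  count-head? : ∀ {x xs n} → Count P (x ∷ xs) n → Dec (P x)
  count-head? (c-yes p _) = yes p
  count-head? (c-no ¬p _) = no ¬p

  count-∷⁻ : ∀ {x xs n} (P? : Dec (P x)) → Count P (x ∷ xs) n →
             ∃ λ n′ → Count P xs n′ × n ≡ (if does P? then 1 else 0) + n′
  count-∷⁻ P? (c-yes p c) rewrite dec-true P? p  = _ , c , refl
  count-∷⁻ P? (c-no ¬p c) rewrite dec-false P? ¬p = _ , c , refl

count-ext : ∀ {P Q : A → Set} {xs n} → (∀ {x} → x ∈ xs → P x ⇔ Q x) → Count P xs n → Count Q xs n
count-ext eq c-nil       = c-nil
count-ext eq (c-yes p c) = c-yes (to (eq (here refl)) p) (count-ext (eq ∘ there) c)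
count-ext eq (c-no ¬p c) = c-no (¬p ∘ from (eq (here refl))) (count-ext (eq ∘ there) c)

count-map : ∀ {P : Y → Set} (h : X → Y) {xs n} → Count (P ∘ h) xs n → Count P (map h xs) n
count-map h c-nil       = c-nil
count-map h (c-yes p c) = c-yes p (count-map h c)
count-map h (c-no ¬p c) = c-no ¬p (count-map h c)

infixl 6 _+ᵥ_ _∸ᵥ_
infix 4 _≤ᵥ_ _≤ᵥ?_ _≟ᵥ_

_+ᵥ_ _∸ᵥ_ : Vec ℕ N → Vec ℕ N → Vec ℕ N
_+ᵥ_ = zipWith _+_
_∸ᵥ_ = zipWith _∸_

_≤ᵥ_ : Vec ℕ N → Vec ℕ N → Set
_≤ᵥ_ = Pointwise _≤_

_≤ᵥ?_ : (u v : Vec ℕ N) → Dec (u ≤ᵥ v)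
_≤ᵥ?_ = Pointwise.decidable _≤?_

_≟ᵥ_ : (u v : Vec ℕ N) → Dec (u ≡ v)
_≟ᵥ_ = ≡-dec _≟_

+ᵥ-≡⇒≤ᵥ : (u v α : Vec ℕ N) → u +ᵥ v ≡ α → u ≤ᵥ α
+ᵥ-≡⇒≤ᵥ []      []      []      _    = []
+ᵥ-≡⇒≤ᵥ (a ∷ u) (b ∷ v) (c ∷ α) eq with ∷-injective eq
... | a+b≡c , rest = subst (a ≤_) a+b≡c (m≤m+n a b) ∷ +ᵥ-≡⇒≤ᵥ u v α rest

+ᵥ-∸ᵥ : {u α : Vec ℕ N} → u ≤ᵥ α → u +ᵥ (α ∸ᵥ u) ≡ α
+ᵥ-∸ᵥ []         = refl
+ᵥ-∸ᵥ (a≤c ∷ u≤α) = cong₂ _∷_ (m+[n∸m]≡n a≤c) (+ᵥ-∸ᵥ u≤α)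

+ᵥ-cancelˡ : (u v v′ : Vec ℕ N) → u +ᵥ v ≡ u +ᵥ v′ → v ≡ v′
+ᵥ-cancelˡ []      []      []        _  = refl
+ᵥ-cancelˡ (a ∷ u) (b ∷ v) (b′ ∷ v′) eq with ∷-injective eq
... | hd , tl = cong₂ _∷_ (+-cancelˡ-≡ a b b′ hd) (+ᵥ-cancelˡ u v v′ tl)

+ᵥ-≡⇔≡∸ᵥ : {u v α : Vec ℕ N} → u ≤ᵥ α → (u +ᵥ v ≡ α) ⇔ (v ≡ α ∸ᵥ u)
+ᵥ-≡⇔≡∸ᵥ {u = u} {v} {α} u≤α = mk⇔
  (λ eq → +ᵥ-cancelˡ u v (α ∸ᵥ u) (trans eq (sym (+ᵥ-∸ᵥ u≤α))))
  (λ { refl → +ᵥ-∸ᵥ u≤α })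

sum-map-concatMap : (F : Y → ℕ) (g : X → List Y) (xs : List X) →
  sum (map F (concatMap g xs)) ≡ sum (map (λ x → sum (map F (g x))) xs)
sum-map-concatMap F g []       = refl
sum-map-concatMap F g (x ∷ xs) = begin
  sum (map F (g x ++ concatMap g xs))                 ≡⟨ cong sum (List.map-++ F (g x) _) ⟩
  sum (map F (g x) ++ map F (concatMap g xs))         ≡⟨ sum-++ (map F (g x)) _ ⟩
  sum (map F (g x)) + sum (map F (concatMap g xs))    ≡⟨ cong (sum (map F (g x)) +_) (sum-map-concatMap F g xs) ⟩
  sum (map F (g x)) + sum (map (λ x → sum (map F (g x))) xs) ∎
  where open ≡-Reasoning

sum-map-+ : (F G : X → ℕ) (xs : List X) →
  sum (map (λ x → F x + G x) xs) ≡ sum (map F xs) + sum (map G xs)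
sum-map-+ F G []       = refl
sum-map-+ F G (x ∷ xs) rewrite sum-map-+ F G xs = interchange +-commutativeSemigroup (F x) (G x) _ _

sum-map-zero : (F : X → ℕ) (xs : List X) → (∀ x → F x ≡ 0) → sum (map F xs) ≡ 0
sum-map-zero F []       _    = refl
sum-map-zero F (x ∷ xs) F≡0 rewrite F≡0 x = sum-map-zero F xs F≡0

sum-if : (b : Bool) (F : X → ℕ) (xs : List X) →
  sum (map (λ x → if b then F x else 0) xs) ≡ (if b then sum (map F xs) else 0)
sum-if true  F xs = refl
sum-if false F xs = sum-map-zero _ xs λ _ → refl

sum-applyUpTo-zero : (m : ℕ) → sum (applyUpTo (λ _ → 0) m) ≡ 0
sum-applyUpTo-zero zero    = refl
sum-applyUpTo-zero (suc m) = sum-applyUpTo-zero m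

sum-applyUpTo-at : (w m : ℕ) (K : ℕ → ℕ) →
  sum (applyUpTo (λ i → if does (w ≟ i) then K i else 0) m) ≡ (if does (w <? m) then K w else 0)
sum-applyUpTo-at w       zero    K = refl
sum-applyUpTo-at zero    (suc m) K = trans (cong (K 0 +_) (sum-applyUpTo-zero m)) (+-identityʳ (K 0))
sum-applyUpTo-at (suc w) (suc m) K = sum-applyUpTo-at w m (K ∘ suc)

if-∧ : (b c : Bool) (n : ℕ) → (if b ∧ c then n else 0) ≡ (if b then (if c then n else 0) else 0)
if-∧ true  c n = refl
if-∧ false c n = refl

<?-suc : (m n : ℕ) → does (m <? suc n) ≡ does (m ≤? n)
<?-suc zero    n = refl
<?-suc (suc m) n = refl

sum-splits-at : (α v : Vec ℕ N) (h : Vec ℕ N → ℕ) →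
  sum (map (λ s → if does (v ≟ᵥ proj₁ s) then h (proj₂ s) else 0) (splits α))
    ≡ (if does (v ≤ᵥ? α) then h (α ∸ᵥ v) else 0)
sum-splits-at []      []      h = +-identityʳ (h [])
sum-splits-at (a ∷ α) (w ∷ v) h = begin
  sum (map F (concatMap row (upTo (suc a))))
    ≡⟨ sum-map-concatMap F row (upTo (suc a)) ⟩
  sum (map (λ i → sum (map F (row i))) (upTo (suc a)))
    ≡⟨ cong sum (List.map-cong row-sum (upTo (suc a))) ⟩
  sum (map (λ i → if does (w ≟ i) then K i else 0) (upTo (suc a)))
    ≡⟨ cong sum (List.map-upTo (λ i → if does (w ≟ i) then K i else 0) (suc a)) ⟩
  sum (applyUpTo (λ i → if does (w ≟ i) then K i else 0) (suc a))
    ≡⟨ sum-applyUpTo-at w (suc a) K ⟩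
  (if does (w <? suc a) then K w else 0)
    ≡⟨ cong (λ b → if b then K w else 0) (<?-suc w a) ⟩
  (if does (w ≤? a) then K w else 0)
    ≡⟨ if-∧ (does (w ≤? a)) _ _ ⟨
  (if does (w ≤? a) ∧ does (v ≤ᵥ? α) then h ((a ∸ w) ∷ (α ∸ᵥ v)) else 0) ∎
  where
  open ≡-Reasoning
  F : Vec ℕ (suc _) × Vec ℕ (suc _) → ℕ
  F s = if does ((w ∷ v) ≟ᵥ proj₁ s) then h (proj₂ s) else 0
  row : ℕ → List (Vec ℕ (suc _) × Vec ℕ (suc _))
  row i = map (λ s → (i ∷ proj₁ s) , ((a ∸ i) ∷ proj₂ s)) (splits α)
  G : ℕ → Vec ℕ _ × Vec ℕ _ → ℕ
  G i s = if does (v ≟ᵥ proj₁ s) then h ((a ∸ i) ∷ proj₂ s) else 0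
  K : ℕ → ℕ
  K i = if does (v ≤ᵥ? α) then h ((a ∸ i) ∷ (α ∸ᵥ v)) else 0
  row-sum : ∀ i → sum (map F (row i)) ≡ (if does (w ≟ i) then K i else 0)
  row-sum i = begin
    sum (map F (row i))
      ≡⟨ cong sum (trans (sym (List.map-∘ (splits α))) (List.map-cong (λ s → if-∧ (does (w ≟ i)) _ _) (splits α))) ⟩
    sum (map (λ s → if does (w ≟ i) then G i s else 0) (splits α))
      ≡⟨ sum-if (does (w ≟ i)) (G i) (splits α) ⟩
    (if does (w ≟ i) then sum (map (G i) (splits α)) else 0)
      ≡⟨ cong (λ n → if does (w ≟ i) then n else 0) (sum-splits-at α v (λ γ → h ((a ∸ i) ∷ γ))) ⟩
    (if does (w ≟ i) then K i else 0) ∎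

prodCoeff-cong : {c c′ : Vec ℕ N → ℕ} (d : Vec ℕ N → ℕ) (α : Vec ℕ N) →
  (∀ β → c β ≡ c′ β) → prodCoeff c d α ≡ prodCoeff c′ d α
prodCoeff-cong d α c≗c′ = cong sum (List.map-cong (λ s → cong (_* d (proj₂ s)) (c≗c′ (proj₁ s))) (splits α))

prodCoeff-+ˡ : (c c′ d : Vec ℕ N → ℕ) (α : Vec ℕ N) →
  prodCoeff (λ β → c β + c′ β) d α ≡ prodCoeff c d α + prodCoeff c′ d α
prodCoeff-+ˡ c c′ d α = trans
  (cong sum (List.map-cong (λ s → *-distribʳ-+ (d (proj₂ s)) (c (proj₁ s)) (c′ (proj₁ s))) (splits α)))
  (sum-map-+ _ _ (splits α))

prodCoeff-zeroˡ : (d : Vec ℕ N → ℕ) (α : Vec ℕ N) → prodCoeff (λ _ → 0) d α ≡ 0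
prodCoeff-zeroˡ d α = sum-map-zero _ (splits α) λ _ → refl

prodCoeff-δ : (v : Vec ℕ N) (d : Vec ℕ N → ℕ) (α : Vec ℕ N) →
  prodCoeff (λ β → if does (v ≟ᵥ β) then 1 else 0) d α ≡ (if does (v ≤ᵥ? α) then d (α ∸ᵥ v) else 0)
prodCoeff-δ v d α = trans
  (cong sum (List.map-cong (λ s → if-* (does (v ≟ᵥ proj₁ s)) (d (proj₂ s))) (splits α)))
  (sum-splits-at α v d)
  where
  if-* : ∀ b n → (if b then 1 else 0) * n ≡ (if b then n else 0)
  if-* true  n = +-identityʳ n
  if-* false n = refl

module _ {Q : Y → Set} (w₂ : Y → Vec ℕ N) {ys : List Y} {cQ : Vec ℕ N → ℕ}
         (countQ : ∀ γ → Count (λ y → Q y × w₂ y ≡ γ) ys (cQ γ)) (α : Vec ℕ N) where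

  count-shift : (u : Vec ℕ N) →
    Count (λ y → Q y × u +ᵥ w₂ y ≡ α) ys (if does (u ≤ᵥ? α) then cQ (α ∸ᵥ u) else 0)
  count-shift u with u ≤ᵥ? α
  ... | yes u≤α = count-ext (λ _ → mk⇔ (λ (q , eq) → q , from (+ᵥ-≡⇔≡∸ᵥ u≤α) eq)
                                       (λ (q , eq) → q , to (+ᵥ-≡⇔≡∸ᵥ u≤α) eq))
                            (countQ (α ∸ᵥ u))
  ... | no  u≰α = count-none ys λ _ (_ , eq) → u≰α (+ᵥ-≡⇒≤ᵥ u (w₂ _) α eq)

  count-convolution : {P : X → Set} {R : Z → Set} (_⊕_ : X → Y → Z) (w₁ : X → Vec ℕ N)
    (xs : List X) (cP : Vec ℕ N → ℕ) →
    (∀ β → Count (λ x → P x × w₁ x ≡ β) xs (cP β)) →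
    (∀ {x y} → x ∈ xs → y ∈ ys → R (x ⊕ y) ⇔ ((P x × Q y) × w₁ x +ᵥ w₂ y ≡ α)) →
    Count R (cartesianProductWith _⊕_ xs ys) (prodCoeff cP cQ α)
  count-convolution {R = R} _ _ [] cP countP _ = subst (Count R []) (sym (begin
    prodCoeff cP cQ α         ≡⟨ prodCoeff-cong cQ α (λ β → count-unique (countP β) c-nil) ⟩
    prodCoeff (λ _ → 0) cQ α  ≡⟨ prodCoeff-zeroˡ cQ α ⟩
    0                         ∎)) c-nil
    where open ≡-Reasoning
  count-convolution {P = P} {R = R} _⊕_ w₁ (x ∷ xs) cP countP R⇔ =
    subst (Count R _) (sym coeff) (count-++ (count-map (x ⊕_) (head P?)) tail)
    where
    -- P need not be decidable: whether x satisfies it is read off from its count at its own weight.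
    P? : Dec (P x)
    P? = map′ proj₁ (_, refl) (count-head? (countP (w₁ x)))
    δ : Vec ℕ N → ℕ
    δ β = if does P? ∧ does (w₁ x ≟ᵥ β) then 1 else 0
    peel : ∀ β → ∃ λ n → Count (λ x → P x × w₁ x ≡ β) xs n × cP β ≡ δ β + n
    peel β = count-∷⁻ (P? ×-dec (w₁ x ≟ᵥ β)) (countP β)
    coeff : prodCoeff cP cQ α ≡ prodCoeff δ cQ α + prodCoeff (proj₁ ∘ peel) cQ α
    coeff = trans (prodCoeff-cong cQ α (proj₂ ∘ proj₂ ∘ peel)) (prodCoeff-+ˡ δ _ cQ α)
    tail : Count R (cartesianProductWith _⊕_ xs ys) (prodCoeff (proj₁ ∘ peel) cQ α)
    tail = count-convolution _⊕_ w₁ xs _ (proj₁ ∘ proj₂ ∘ peel) (R⇔ ∘ there)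
    head : (d : Dec (P x)) →
      Count (R ∘ (x ⊕_)) ys (prodCoeff (λ β → if does d ∧ does (w₁ x ≟ᵥ β) then 1 else 0) cQ α)
    head (yes p) = subst (Count _ ys) (sym (prodCoeff-δ (w₁ x) cQ α))
                    (count-ext (λ y∈ → mk⇔ (λ (q , eq) → from (R⇔ (here refl) y∈) ((p , q) , eq))
                                           (λ r → let ((_ , q) , eq) = to (R⇔ (here refl) y∈) r in q , eq))
                               (count-shift (w₁ x)))
    head (no ¬p) = subst (Count _ ys) (sym (prodCoeff-zeroˡ cQ α))
                    (count-none ys λ y∈ r → ¬p (proj₁ (proj₁ (to (R⇔ (here refl) y∈) r))))

multiplicity : ℕ → Assignment → ℕ
multiplicity k f = length (filter (λ p → mag (proj₂ p) ≟ k) f)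

weight : (N : ℕ) → Assignment → Vec ℕ N
weight N f = tabulate λ k → multiplicity (toℕ k) f

hasWeight⇔ : (f : Assignment) {α : Vec ℕ N} → HasWeight f α ⇔ weight N f ≡ α
hasWeight⇔ f {α} = mk⇔ (λ hw → trans (tabulate-cong hw) (tabulate∘lookup α))
                         (λ eq k → trans (sym (lookup∘tabulate _ k)) (cong (λ v → lookup v k) eq))

multiplicity-++ : (k : ℕ) (f g : Assignment) → multiplicity k (f ++ g) ≡ multiplicity k f + multiplicity k g
multiplicity-++ k f g = trans (cong length (List.filter-++ _ f g)) (List.length-++ (filter _ f))

tabulate-+ : (F G : Fin N → ℕ) → tabulate (λ k → F k + G k) ≡ tabulate F +ᵥ tabulate G
tabulate-+ {N = zero}  F G = refl
tabulate-+ {N = suc N} F G = cong (F Fin.zero + G Fin.zero ∷_) (tabulate-+ (F ∘ Fin.suc) (G ∘ Fin.suc))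

weight-++ : (f g : Assignment) → weight N (f ++ g) ≡ weight N f +ᵥ weight N g
weight-++ f g = trans (tabulate-cong λ k → multiplicity-++ (toℕ k) f g) (tabulate-+ _ _)

hasWeight-++⇔ : (f g : Assignment) {α : Vec ℕ N} → HasWeight (f ++ g) α ⇔ (weight N f +ᵥ weight N g ≡ α)
hasWeight-++⇔ f g = mk⇔ (λ hw → trans (sym (weight-++ f g)) (to (hasWeight⇔ (f ++ g)) hw))
                        (λ eq → from (hasWeight⇔ (f ++ g)) (trans (weight-++ f g) eq))

KeysIn : List ℕ → Assignment → Set
KeysIn vs f = ∀ {i a} → (i , a) ∈ f → i ∈ vs

assignments-keys : ∀ N vs {f} → f ∈ assignments N vs → KeysIn vs f
assignments-keys N []       (here refl) ()
assignments-keys N (v ∷ vs) f∈ ia∈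
  with _ , f∈′ ← Any.satisfied (∈-concatMap⁻ _ {xs = valsUpTo N} f∈)
  with _ , f′∈ , refl ← ∈-map⁻ _ f∈′
  with ia∈
... | here refl = here refl
... | there ia∈′ = there (assignments-keys N vs f′∈ ia∈′)

cartesianProductWith-concatMap : (_⊕_ : X → Y → Z) (g : A → List X) (as : List A) (ys : List Y) →
  cartesianProductWith _⊕_ (concatMap g as) ys ≡ concatMap (λ a → cartesianProductWith _⊕_ (g a) ys) as
cartesianProductWith-concatMap _⊕_ g []       ys = refl
cartesianProductWith-concatMap _⊕_ g (a ∷ as) ys = trans
  (List.cartesianProductWith-distribʳ-++ _⊕_ (g a) (concatMap g as) ys)
  (cong (cartesianProductWith _⊕_ (g a) ys ++_) (cartesianProductWith-concatMap _⊕_ g as ys))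

cartesianProductWith-++-map-∷ : (e : ℕ × P') (fs gs : List Assignment) →
  cartesianProductWith _++_ (map (e ∷_) fs) gs ≡ map (e ∷_) (cartesianProductWith _++_ fs gs)
cartesianProductWith-++-map-∷ e []       gs = refl
cartesianProductWith-++-map-∷ e (f ∷ fs) gs = begin
  map ((e ∷ f) ++_) gs ++ cartesianProductWith _++_ (map (e ∷_) fs) gs
    ≡⟨ cong₂ _++_ (List.map-∘ gs) (cartesianProductWith-++-map-∷ e fs gs) ⟩
  map (e ∷_) (map (f ++_) gs) ++ map (e ∷_) (cartesianProductWith _++_ fs gs)
    ≡⟨ List.map-++ (e ∷_) (map (f ++_) gs) _ ⟨
  map (e ∷_) (map (f ++_) gs ++ cartesianProductWith _++_ fs gs) ∎
  where open ≡-Reasoning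

assignments-++ : ∀ N vs ws →
  assignments N (vs ++ ws) ≡ cartesianProductWith _++_ (assignments N vs) (assignments N ws)
assignments-++ N []       ws = sym (trans (List.++-identityʳ _) (List.map-id (assignments N ws)))
assignments-++ N (v ∷ vs) ws = begin
  concatMap (λ a → map ((v , a) ∷_) (assignments N (vs ++ ws))) (valsUpTo N)
    ≡⟨ List.concatMap-cong (λ a → cong (map ((v , a) ∷_)) (assignments-++ N vs ws)) (valsUpTo N) ⟩
  concatMap (λ a → map ((v , a) ∷_) (cartesianProductWith _++_ fs gs)) (valsUpTo N)
    ≡⟨ List.concatMap-cong (λ a → cartesianProductWith-++-map-∷ (v , a) fs gs) (valsUpTo N) ⟨
  concatMap (λ a → cartesianProductWith _++_ (map ((v , a) ∷_) fs) gs) (valsUpTo N)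
    ≡⟨ cartesianProductWith-concatMap _++_ (λ a → map ((v , a) ∷_) fs) (valsUpTo N) gs ⟨
  cartesianProductWith _++_ (concatMap (λ a → map ((v , a) ∷_) fs) (valsUpTo N)) gs ∎
  where
  open ≡-Reasoning
  fs = assignments N vs
  gs = assignments N ws

ArcsWithin : List ℕ → Digraph → Set
ArcsWithin vs D = ∀ {i j} → Arc D i j → i ∈ vs × j ∈ vs

Isolated : Digraph → ℕ → Set
Isolated D i = IsSource D i × IsSink D i

flipAt-arc⁻ : ∀ {i D a b} → Arc (flipAt i D) a b → Arc D a b ⊎ Arc D b a
flipAt-arc⁻ {i} ab∈ with (x , y) , xy∈ , refl ← ∈-map⁻ (flipArc i) ab∈ with (x ≡ᵇ i) ∨ (y ≡ᵇ i)
... | true  = inj₂ xy∈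
... | false = inj₁ xy∈

arcsWithin-flipAt : ∀ {vs} i D → ArcsWithin vs D → ArcsWithin vs (flipAt i D)
arcsWithin-flipAt i D within ab with flipAt-arc⁻ {i} {D} ab
... | inj₁ ab′ = within ab′
... | inj₂ ba  = swap (within ba)

flipAt-isolated : ∀ {D i} → Isolated D i → flipAt i D ≡ D
flipAt-isolated {D} {i} (source , sink) =
  cong (digraph (verts D)) (List.map-id-local (All.tabulate fixed))
  where
  fixed : ∀ {a} → a ∈ arcs D → flipArc i a ≡ a
  fixed {x , y} xy∈
    rewrite dec-false (x ≟ i) (λ { refl → sink y xy∈ })
          | dec-false (y ≟ i) (λ { refl → source x xy∈ }) = refl

flipAt-⊎ : ∀ i D E → flipAt i (D ⊎ᴰ E) ≡ flipAt i D ⊎ᴰ flipAt i E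
flipAt-⊎ i D E = cong (digraph (verts D ++ verts E)) (List.map-++ (flipArc i) (arcs D) (arcs E))

isolated-outside : ∀ E {i} → ArcsWithin (verts E) E → ¬ i ∈ verts E → Isolated E i
isolated-outside E within i∉ = (λ j ji → i∉ (proj₂ (within ji))) , (λ j ij → i∉ (proj₁ (within ij)))

module _ (D E : Digraph) {i : ℕ} where

  isSource-⊎ : IsSource D i → IsSource E i → IsSource (D ⊎ᴰ E) i
  isSource-⊎ sD sE j ji = [ sD j , sE j ]′ (∈-++⁻ (arcs D) ji)

  isSink-⊎ : IsSink D i → IsSink E i → IsSink (D ⊎ᴰ E) i
  isSink-⊎ sD sE j ij = [ sD j , sE j ]′ (∈-++⁻ (arcs D) ij)

  sourceOrSink-⊎ˡ : Isolated E i → IsSource D i ⊎ IsSink D i → IsSource (D ⊎ᴰ E) i ⊎ IsSink (D ⊎ᴰ E) i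
  sourceOrSink-⊎ˡ (sE , tE) = Sum.map (λ sD → isSource-⊎ sD sE) (λ tD → isSink-⊎ tD tE)

  sourceOrSink-⊎ʳ : Isolated D i → IsSource E i ⊎ IsSink E i → IsSource (D ⊎ᴰ E) i ⊎ IsSink (D ⊎ᴰ E) i
  sourceOrSink-⊎ʳ (sD , tD) = Sum.map (isSource-⊎ sD) (isSink-⊎ tD)

  sourceOrSink-⊎⁻ˡ : IsSource (D ⊎ᴰ E) i ⊎ IsSink (D ⊎ᴰ E) i → IsSource D i ⊎ IsSink D i
  sourceOrSink-⊎⁻ˡ = Sum.map (λ s j → s j ∘ ∈-++⁺ˡ) (λ t j → t j ∘ ∈-++⁺ˡ)

  sourceOrSink-⊎⁻ʳ : IsSource (D ⊎ᴰ E) i ⊎ IsSink (D ⊎ᴰ E) i → IsSource E i ⊎ IsSink E i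
  sourceOrSink-⊎⁻ʳ = Sum.map (λ s j → s j ∘ ∈-++⁺ʳ (arcs D)) (λ t j → t j ∘ ∈-++⁺ʳ (arcs D))

Separated : Digraph → Digraph → Set
Separated D E = ArcsWithin (verts D) D × ArcsWithin (verts E) E × DisjointVerts D E

separated : ∀ {D E} → WellFormed D → WellFormed E → DisjointVerts D E → Separated D E
separated (_ , _ , inD) (_ , _ , inE) disjoint = All.lookup inD , All.lookup inE , disjoint

module _ {D E : Digraph} where

  separated-flipˡ : ∀ {D′} → FlipStep D D′ → Separated D E → Separated D′ E
  separated-flipˡ (flip i _ _) (inD , inE , disjoint) = arcsWithin-flipAt i D inD , inE , disjoint

  separated-flipʳ : ∀ {E′} → FlipStep E E′ → Separated D E → Separated D E′
  separated-flipʳ (flip i _ _) (inD , inE , disjoint) = inD , arcsWithin-flipAt i E inE , disjoint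

  flipAt-⊎ˡ : ∀ {i} → Separated D E → i ∈ verts D → flipAt i (D ⊎ᴰ E) ≡ flipAt i D ⊎ᴰ E
  flipAt-⊎ˡ {i} (_ , inE , disjoint) i∈D = trans (flipAt-⊎ i D E)
    (cong (flipAt i D ⊎ᴰ_) (flipAt-isolated (isolated-outside E inE (disjoint i i∈D))))

  flipAt-⊎ʳ : ∀ {i} → Separated D E → i ∈ verts E → flipAt i (D ⊎ᴰ E) ≡ D ⊎ᴰ flipAt i E
  flipAt-⊎ʳ {i} (inD , _ , disjoint) i∈E = trans (flipAt-⊎ i D E)
    (cong (_⊎ᴰ flipAt i E) (flipAt-isolated (isolated-outside D inD (λ i∈D → disjoint i i∈D i∈E))))

  flipStep-⊎ˡ : ∀ {D′} → Separated D E → FlipStep D D′ → FlipStep (D ⊎ᴰ E) (D′ ⊎ᴰ E)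
  flipStep-⊎ˡ sep@(_ , inE , disjoint) (flip i i∈ ss) = subst (FlipStep (D ⊎ᴰ E)) (flipAt-⊎ˡ sep i∈)
    (flip i (∈-++⁺ˡ i∈) (sourceOrSink-⊎ˡ D E (isolated-outside E inE (disjoint i i∈)) ss))

  flipStep-⊎ʳ : ∀ {E′} → Separated D E → FlipStep E E′ → FlipStep (D ⊎ᴰ E) (D ⊎ᴰ E′)
  flipStep-⊎ʳ sep@(inD , _ , disjoint) (flip i i∈ ss) = subst (FlipStep (D ⊎ᴰ E)) (flipAt-⊎ʳ sep i∈)
    (flip i (∈-++⁺ʳ (verts D) i∈) (sourceOrSink-⊎ʳ D E (isolated-outside D inD (λ i∈D → disjoint i i∈D i∈)) ss))

  flipStep-⊎⁻ : ∀ {X} → Separated D E → FlipStep (D ⊎ᴰ E) X →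
    (∃ λ D′ → FlipStep D D′ × X ≡ D′ ⊎ᴰ E) ⊎ (∃ λ E′ → FlipStep E E′ × X ≡ D ⊎ᴰ E′)
  flipStep-⊎⁻ sep (flip i i∈ ss) with ∈-++⁻ (verts D) i∈
  ... | inj₁ i∈D = inj₁ (_ , flip i i∈D (sourceOrSink-⊎⁻ˡ D E ss) , flipAt-⊎ˡ sep i∈D)
  ... | inj₂ i∈E = inj₂ (_ , flip i i∈E (sourceOrSink-⊎⁻ʳ D E ss) , flipAt-⊎ʳ sep i∈E)

inToric-⊎ : ∀ {D E D′ E′} → Separated D E → InToric D D′ → InToric E E′ → InToric (D ⊎ᴰ E) (D′ ⊎ᴰ E′)
inToric-⊎ sep ε        ε        = ε
inToric-⊎ sep (s ◅ ss) tE       = flipStep-⊎ˡ sep s ◅ inToric-⊎ (separated-flipˡ s sep) ss tE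
inToric-⊎ sep ε        (t ◅ ts) = flipStep-⊎ʳ sep t ◅ inToric-⊎ (separated-flipʳ t sep) ε ts

inToric-⊎⁻ : ∀ {D E X} → Separated D E → InToric (D ⊎ᴰ E) X →
  ∃ λ D′ → ∃ λ E′ → InToric D D′ × InToric E E′ × X ≡ D′ ⊎ᴰ E′
inToric-⊎⁻ {D} {E} sep ε = D , E , ε , ε , refl
inToric-⊎⁻ sep (s ◅ ss) with flipStep-⊎⁻ sep s
... | inj₁ (_ , t , refl) =
  let D′ , E′ , tD , tE , eq = inToric-⊎⁻ (separated-flipˡ t sep) ss in D′ , E′ , t ◅ tD , tE , eq
... | inj₂ (_ , t , refl) =
  let D′ , E′ , tD , tE , eq = inToric-⊎⁻ (separated-flipʳ t sep) ss in D′ , E′ , tD , t ◅ tE , eq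

arcsWithin-inToric : ∀ {vs D D′} → ArcsWithin vs D → InToric D D′ → ArcsWithin vs D′
arcsWithin-inToric within ε                    = within
arcsWithin-inToric within (flip {D} i _ _ ◅ ss) = arcsWithin-inToric (arcsWithin-flipAt i D within) ss

entry-++ˡ : ∀ {ws f g i a} → KeysIn ws g → ¬ i ∈ ws → (i , a) ∈ f ++ g → (i , a) ∈ f
entry-++ˡ {f = f} keys i∉ ia∈ = [ id , ⊥-elim ∘ i∉ ∘ keys ]′ (∈-++⁻ f ia∈)

entry-++ʳ : ∀ {vs f g i a} → KeysIn vs f → ¬ i ∈ vs → (i , a) ∈ f ++ g → (i , a) ∈ g
entry-++ʳ {f = f} keys i∉ ia∈ = [ ⊥-elim ∘ i∉ ∘ keys , id ]′ (∈-++⁻ f ia∈)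

module _ {D E : Digraph} {f g : Assignment} where

  enriched-⊎⁻ : IsEnriched (D ⊎ᴰ E) (f ++ g) → IsEnriched D f × IsEnriched E g
  enriched-⊎⁻ enr =
    (λ i j a b ij ia jb → enr i j a b (∈-++⁺ˡ ij) (∈-++⁺ˡ ia) (∈-++⁺ˡ jb)) ,
    (λ i j a b ij ia jb → enr i j a b (∈-++⁺ʳ (arcs D) ij) (∈-++⁺ʳ f ia) (∈-++⁺ʳ f jb))

  enriched-⊎ : ∀ {vs ws} → ArcsWithin vs D → ArcsWithin ws E → (∀ v → v ∈ vs → ¬ v ∈ ws) →
    KeysIn vs f → KeysIn ws g → IsEnriched D f → IsEnriched E g → IsEnriched (D ⊎ᴰ E) (f ++ g)
  enriched-⊎ inD inE disjoint keysf keysg enrD enrE i j a b ij ia jb with ∈-++⁻ (arcs D) ij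
  ... | inj₁ ijD = let i∈ , j∈ = inD ijD in
    enrD i j a b ijD (entry-++ˡ keysg (disjoint i i∈) ia) (entry-++ˡ keysg (disjoint j j∈) jb)
  ... | inj₂ ijE = let i∈ , j∈ = inE ijE in
    enrE i j a b ijE (entry-++ʳ keysf (λ i∈D → disjoint i i∈D i∈) ia)
                     (entry-++ʳ keysf (λ j∈D → disjoint j j∈D j∈) jb)

enrichedToric-⊎ : ∀ {D E f g} → Separated D E → KeysIn (verts D) f → KeysIn (verts E) g →
  IsEnrichedToric (D ⊎ᴰ E) (f ++ g) ⇔ (IsEnrichedToric D f × IsEnrichedToric E g)
enrichedToric-⊎ {D} {E} {f} {g} sep@(inD , inE , disjoint) keysf keysg = mk⇔ split join
  where
  split : IsEnrichedToric (D ⊎ᴰ E) (f ++ g) → IsEnrichedToric D f × IsEnrichedToric E g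
  split (X , tX , enr) with inToric-⊎⁻ sep tX
  ... | D′ , E′ , tD , tE , refl =
    let enrD , enrE = enriched-⊎⁻ {D′} {E′} enr in (D′ , tD , enrD) , (E′ , tE , enrE)
  join : IsEnrichedToric D f × IsEnrichedToric E g → IsEnrichedToric (D ⊎ᴰ E) (f ++ g)
  join ((D′ , tD , enrD) , (E′ , tE , enrE)) =
    D′ ⊎ᴰ E′ , inToric-⊎ sep tD tE ,
    enriched-⊎ {D′} {E′} (arcsWithin-inToric inD tD) (arcsWithin-inToric inE tE) disjoint
      keysf keysg enrD enrE

mainTheorem5 : (D E : Digraph) → IsDAG D → IsDAG E → DisjointVerts D E →
    (N : ℕ) (cD cE cDE : Vec ℕ N → ℕ) →
    (∀ β → CoeffIs D β (cD β)) →
    (∀ β → CoeffIs E β (cE β)) →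
    (∀ β → CoeffIs (D ⊎ᴰ E) β (cDE β)) →
    ∀ α → cDE α ≡ prodCoeff cD cE α
mainTheorem5 D E (wfD , _) (wfE , _) disjoint N cD cE cDE hD hE hDE α =
  count-unique (hDE α)
    (subst (λ fs → Count ToricOfWeightα fs (prodCoeff cD cE α)) (sym (assignments-++ N (verts D) (verts E)))
      (count-convolution (weight N) (byWeight E hE) α _++_ (weight N) _ cD (byWeight D hD) split))
  where
  ToricOfWeightα : Assignment → Set
  ToricOfWeightα h = IsEnrichedToric (D ⊎ᴰ E) h × HasWeight h α
  byWeight : ∀ G {c : Vec ℕ N → ℕ} → (∀ β → CoeffIs G β (c β)) →
    ∀ β → Count (λ f → IsEnrichedToric G f × weight N f ≡ β) (assignments N (verts G)) (c β)
  byWeight G coeff β = count-ext (λ {f} _ → ⇔-id _ ×-⇔ hasWeight⇔ f) (coeff β)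
  split : ∀ {f g} → f ∈ assignments N (verts D) → g ∈ assignments N (verts E) →
    ToricOfWeightα (f ++ g) ⇔ ((IsEnrichedToric D f × IsEnrichedToric E g) × weight N f +ᵥ weight N g ≡ α)
  split {f} {g} f∈ g∈ =
    enrichedToric-⊎ (separated wfD wfE disjoint) (assignments-keys N _ f∈) (assignments-keys N _ g∈)
      ×-⇔ hasWeight-++⇔ f g
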